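{- Let $A$ and $A'$ be forcing arc sets of finite simple graphs $G=(V,E)$ and $G'=(V',E')$, respectively, and let $G^*=G\boxtimes G'$. Define $$A^*=\{((u,u'),(v,v')) : (u,v)\in A,\ (u',v')\in A'\}.$$ Then $A^*$ is a forcing arc set of $G^*$.
   Context: The strong product $G\boxtimes G'$ has vertex set $V\times V'$, with $(u,u')(v,v')$ an edge if either $u=v$ and $u'v'\in E'$, or $uv\in E$ and $u'=v'$, or $uv\in E$ and $u'v'\in E'$. Zero forcing: a blue vertex $u$ may force a white neighbour $v$ if $v$ is the only white vertex in $N[u]$. An arc set of a graph $H=(U,F)$ is a set of ordered pairs $(u,v)$ with $uv\in F$ such that $(u,v)$ in the set implies $(v,u)$ is not. It is a forcing arc set of $H$ if it forms a collection of vertex-disjoint directed paths (possibly of length zero) on $U$ and there is a zero forcing process on $H$ starting from its sources (in-degree zero vertices), with each white vertex forced by exactly one vertex and all vertices ending blue, such that $(u,v)$ is in the set exactly when $u$ forces $v$. -}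

module Defs where

open import Data.Nat using (ℕ)
open import Data.Fin using (Fin)
open import Data.Product using (Σ; _×_; _,_; proj₁; proj₂)
open import Data.Sum using (_⊎_)
open import Data.Unit using (⊤)
open import Data.List using (List; []; _∷_; map)
open import Data.List.Membership.Propositional using (_∈_)
open import Relation.Nullary using (¬_)
open import Relation.Binary.PropositionalEquality using (_≡_; _≢_)
open import Relation.Binary.Construct.Closure.Transitive using (TransClosure)
open import Function.Bundles using (_↔_; _⇔_)

record IsFiniteSimpleGraph (V : Set) (Adj : V → V → Set) : Set where
  field
    size    : ℕ
    finite  : V ↔ Fin size
    adjSym  : ∀ {u v} → Adj u v → Adj v u
    irrefl  : ∀ {u} → ¬ Adj u u

StrongAdj : {V V' : Set} → (V → V → Set) → (V' → V' → Set) → (V × V') → (V × V') → Set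
StrongAdj Adj Adj' (u , u') (v , v') =
  (u ≡ v × Adj' u' v') ⊎ (Adj u v × u' ≡ v') ⊎ (Adj u v × Adj' u' v')

record IsArcSet {V : Set} (Adj : V → V → Set) (A : V → V → Set) : Set where
  field
    arcEdge : ∀ {u v} → A u v → Adj u v
    arcAsym : ∀ {u v} → A u v → ¬ A v u

-- A forms a collection of vertex-disjoint directed paths (possibly of length
-- zero) covering V: in-degree ≤ 1, out-degree ≤ 1, no directed cycle.
record IsPathCollection {V : Set} (A : V → V → Set) : Set where
  field
    inDeg≤1  : ∀ {u w v} → A u v → A w v → u ≡ w
    outDeg≤1 : ∀ {u v w} → A u v → A u w → v ≡ w
    acyclic  : ∀ {u} → ¬ TransClosure A u u

Source : {V : Set} → (V → V → Set) → V → Set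
Source A v = ∀ w → ¬ A w v

InClosedNbhd : {V : Set} → (V → V → Set) → V → V → Set
InClosedNbhd Adj u w = (w ≡ u) ⊎ Adj u w

-- A chronological list of forces (u , v) ("u forces v"), valid from the
-- current blue set B: u is blue, v is white and v is the only white vertex
-- of N[u]; afterwards v is blue.
ValidForcing : {V : Set} → (V → V → Set) → (V → Set) → List (V × V) → Set
ValidForcing Adj B [] = ⊤
ValidForcing Adj B ((u , v) ∷ rest) =
  B u × ¬ B v × InClosedNbhd Adj u v
  × (∀ w → InClosedNbhd Adj u w → w ≢ v → B w)
  × ValidForcing Adj (λ x → B x ⊎ x ≡ v) rest

record IsForcingArcSet {V : Set} (Adj : V → V → Set) (A : V → V → Set) : Set where
  field
    arcSet : IsArcSet Adj A
    paths  : IsPathCollection A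
    forces : List (V × V)
    valid  : ValidForcing Adj (Source A) forces
    forcedOnce : ∀ {u w v} → (u , v) ∈ forces → (w , v) ∈ forces → u ≡ w
    allBlue : ∀ v → Source A v ⊎ v ∈ map proj₂ forces
    arcs⇔forces : ∀ u v → A u v ⇔ ((u , v) ∈ forces)

ProductArcs : {V V' : Set} → (V → V → Set) → (V' → V' → Set) → (V × V') → (V × V') → Set
ProductArcs A A' (u , u') (v , v') = A u v × A' u' v'

module Submission where

-- The product forces are run row by row: for each force u → v of G, in order,
-- and then each force u' → v' of G', in order, (u , u') forces (v , v').  At
-- that moment a neighbour (x , x') ≠ (v , v') of (u , u') is already blue:
-- if x ≠ v then x was blue before u forced v, so (x , x') is a source or was
-- forced in an earlier row (every x' ends blue in G'); if x = v then x' ≠ v'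
-- was blue before u' forced v', so (v , x') is a source or was forced earlier
-- in the current row.  And (v , v') is still white, since v was white before
-- u forced v and v' was white before u' forced v'.

open import Defs
open import Data.Fin.Properties using (inj⇒≟)
open import Data.List using (List; []; _∷_; map; _++_; cartesianProductWith)
open import Data.List.Membership.Propositional using (_∈_)
open import Data.List.Membership.Propositional.Properties
  using (∈-map⁺; ∈-map⁻; ∈-++⁺ˡ; ∈-++⁺ʳ; ∈-++⁻; ∈-cartesianProductWith⁺; ∈-cartesianProductWith⁻)
open import Data.List.Properties using (++-assoc)
open import Data.List.Relation.Unary.Any using (here; there)
open import Data.Product using (_×_; _,_; proj₁; proj₂; ∃-syntax)
open import Data.Sum using (_⊎_; inj₁; inj₂; [_,_]′; map₂)
open import Data.Unit using (tt)
open import Function using (_∘_)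
open import Function.Bundles using (mk⇔; Equivalence)
open import Function.Properties.Inverse using (↔⇒↣)
open import Level using (0ℓ)
open import Relation.Binary.Construct.Closure.Transitive using (TransClosure; [_]; _∷_)
open import Relation.Binary.PropositionalEquality using (_≡_; _≢_; refl; sym; cong; cong₂)
open import Relation.Binary.Definitions using (DecidableEquality)
open import Relation.Nullary using (¬_; yes; no)
open import Relation.Unary using (Pred; _∪_; _≐_)
open import Relation.Unary.Properties using (≐-sym)

private
  variable
    X Y Z : Set

data Split {X : Set} : List X → List X → X → Set where
  here  : ∀ {x xs} → Split (x ∷ xs) [] x
  there : ∀ {x xs pre y} → Split xs pre y → Split (x ∷ xs) (x ∷ pre) y

Split⇒∈ : ∀ {L pre} {x : X} → Split L pre x → x ∈ L
Split⇒∈ here      = here refl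
Split⇒∈ (there s) = there (Split⇒∈ s)

split-++ : ∀ (xs : List X) {ys pre x} → Split (xs ++ ys) pre x
  → Split xs pre x ⊎ ∃[ p ] (Split ys p x × pre ≡ xs ++ p)
split-++ []       s         = inj₂ (_ , s , refl)
split-++ (z ∷ xs) here      = inj₁ here
split-++ (z ∷ xs) (there s) with split-++ xs s
... | inj₁ s′              = inj₁ (there s′)
... | inj₂ (p , s′ , refl) = inj₂ (p , s′ , refl)

split-map : ∀ (f : X → Y) (xs : List X) {pre y} → Split (map f xs) pre y
  → ∃[ p ] ∃[ x ] (Split xs p x × pre ≡ map f p × y ≡ f x)
split-map f (x ∷ xs) here      = [] , x , here , refl , refl
split-map f (x ∷ xs) (there s) with split-map f xs s
... | p , x′ , s′ , refl , refl = x ∷ p , x′ , there s′ , refl , refl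

split-cartesianProductWith : ∀ (f : X → Y → Z) xs ys {pre z}
  → Split (cartesianProductWith f xs ys) pre z
  → ∃[ preX ] ∃[ x ] (Split xs preX x × ∃[ preY ] ∃[ y ] (Split ys preY y
      × pre ≡ cartesianProductWith f preX ys ++ map (f x) preY × z ≡ f x y))
split-cartesianProductWith f (x ∷ xs) ys s with split-++ (map (f x) ys) s
... | inj₁ s′ with split-map (f x) ys s′
...   | preY , y , sy , refl , refl = [] , x , here , preY , y , sy , refl , refl
split-cartesianProductWith f (x ∷ xs) ys s | inj₂ (p , s′ , refl)
  with split-cartesianProductWith f xs ys s′
...   | preX , x′ , sx , preY , y , sy , refl , refl =
        x ∷ preX , x′ , there sx , preY , y , sy , sym (++-assoc (map (f x) ys) _ _) , refl

Targets : List (X × Y) → Pred Y 0ℓ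
Targets L y = ∃[ x ] (x , y) ∈ L

∈-map-proj₂⇒Targets : ∀ {L : List (X × Y)} {y} → y ∈ map proj₂ L → Targets L y
∈-map-proj₂⇒Targets m with ∈-map⁻ proj₂ m
... | (x , _) , m′ , refl = x , m′

Targets⇒∈-map-proj₂ : ∀ {L : List (X × Y)} {y} → Targets L y → y ∈ map proj₂ L
Targets⇒∈-map-proj₂ (_ , m) = ∈-map⁺ proj₂ m

Targets-++⁺ˡ : ∀ {xs ys : List (X × Y)} {y} → Targets xs y → Targets (xs ++ ys) y
Targets-++⁺ˡ (x , m) = x , ∈-++⁺ˡ m

Targets-++⁺ʳ : ∀ (xs : List (X × Y)) {ys y} → Targets ys y → Targets (xs ++ ys) y
Targets-++⁺ʳ xs (x , m) = x , ∈-++⁺ʳ xs m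

Targets-++⁻ : ∀ (xs : List (X × Y)) {ys y} → Targets (xs ++ ys) y → Targets xs y ⊎ Targets ys y
Targets-++⁻ xs (x , m) with ∈-++⁻ xs m
... | inj₁ m′ = inj₁ (x , m′)
... | inj₂ m′ = inj₂ (x , m′)

∪-Targets-[] : ∀ (B : Pred X 0ℓ) → (B ∪ Targets {X = Y} []) ≐ B
∪-Targets-[] B = [ (λ b → b) , (λ ()) ]′ , inj₁

∪-Targets-∷ : ∀ (B : Pred Y 0ℓ) {u : X} {v pre}
  → (B ∪ Targets ((u , v) ∷ pre)) ≐ ((B ∪ (_≡ v)) ∪ Targets pre)
∪-Targets-∷ B = to , from
  where
  to : ∀ {y} → (B ∪ Targets _) y → ((B ∪ (_≡ _)) ∪ Targets _) y
  to (inj₁ b)               = inj₁ (inj₁ b)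
  to (inj₂ (_ , here refl)) = inj₁ (inj₂ refl)
  to (inj₂ (x , there m))   = inj₂ (x , m)
  from : ∀ {y} → ((B ∪ (_≡ _)) ∪ Targets _) y → (B ∪ Targets _) y
  from (inj₁ (inj₁ b))    = inj₁ b
  from (inj₁ (inj₂ refl)) = inj₂ (_ , here refl)
  from (inj₂ (x , m))     = inj₂ (x , there m)

module _ {V : Set} (Adj : V → V → Set) where

  record Forces (B : Pred V 0ℓ) (f : V × V) : Set where
    constructor forces
    field
      forcerBlue  : B (proj₁ f)
      forcedWhite : ¬ B (proj₂ f)
      adjacent    : InClosedNbhd Adj (proj₁ f) (proj₂ f)
      othersBlue  : ∀ w → InClosedNbhd Adj (proj₁ f) w → w ≢ proj₂ f → B w

  Forces-resp-≐ : ∀ {B C : Pred V 0ℓ} {f} → B ≐ C → Forces B f → Forces C f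
  Forces-resp-≐ (B⊆C , C⊆B) (forces blueU whiteV uv othersBlue) =
    forces (B⊆C blueU) (whiteV ∘ C⊆B) uv (λ w uw w≢v → B⊆C (othersBlue w uw w≢v))

  validForcing⁺ : ∀ (B : Pred V 0ℓ) L
    → (∀ {pre f} → Split L pre f → Forces (B ∪ Targets pre) f)
    → ValidForcing Adj B L
  validForcing⁺ B []            _          = tt
  validForcing⁺ B ((u , v) ∷ L) eachForces =
    let forces blueU whiteV uv othersBlue = Forces-resp-≐ (∪-Targets-[] B) (eachForces here)
    in  blueU , whiteV , uv , othersBlue
      , validForcing⁺ (B ∪ (_≡ v)) L (Forces-resp-≐ (∪-Targets-∷ B) ∘ eachForces ∘ there)

  validForcing⁻ : ∀ (B : Pred V 0ℓ) {L} → ValidForcing Adj B L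
    → ∀ {pre f} → Split L pre f → Forces (B ∪ Targets pre) f
  validForcing⁻ B (blueU , whiteV , uv , othersBlue , _) here =
    Forces-resp-≐ (≐-sym (∪-Targets-[] B)) (forces blueU whiteV uv othersBlue)
  validForcing⁻ B (_ , _ , _ , _ , valid) (there s) =
    Forces-resp-≐ (≐-sym (∪-Targets-∷ B)) (validForcing⁻ _ valid s)

module StrongClosedNbhd {V V' : Set} (Adj : V → V → Set) (Adj' : V' → V' → Set) where

  closedNbhd-⊠⁺ : ∀ {u u' x x'} → InClosedNbhd Adj u x → InClosedNbhd Adj' u' x'
    → InClosedNbhd (StrongAdj Adj Adj') (u , u') (x , x')
  closedNbhd-⊠⁺ (inj₁ refl) (inj₁ refl) = inj₁ refl
  closedNbhd-⊠⁺ (inj₁ refl) (inj₂ ux')  = inj₂ (inj₁ (refl , ux'))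
  closedNbhd-⊠⁺ (inj₂ ux)   (inj₁ refl) = inj₂ (inj₂ (inj₁ (ux , refl)))
  closedNbhd-⊠⁺ (inj₂ ux)   (inj₂ ux')  = inj₂ (inj₂ (inj₂ (ux , ux')))

  closedNbhd-⊠⁻ : ∀ {u u' x x'} → InClosedNbhd (StrongAdj Adj Adj') (u , u') (x , x')
    → InClosedNbhd Adj u x × InClosedNbhd Adj' u' x'
  closedNbhd-⊠⁻ (inj₁ refl)                      = inj₁ refl , inj₁ refl
  closedNbhd-⊠⁻ (inj₂ (inj₁ (refl , ux')))       = inj₁ refl , inj₂ ux'
  closedNbhd-⊠⁻ (inj₂ (inj₂ (inj₁ (ux , refl)))) = inj₂ ux , inj₁ refl
  closedNbhd-⊠⁻ (inj₂ (inj₂ (inj₂ (ux , ux'))))  = inj₂ ux , inj₂ ux'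

productArcs-isArcSet : ∀ {Adj A : X → X → Set} {Adj' A' : Y → Y → Set}
  → IsArcSet Adj A → IsArcSet Adj' A' → IsArcSet (StrongAdj Adj Adj') (ProductArcs A A')
productArcs-isArcSet arcs arcs' = record
  { arcEdge = λ { {_ , _} {_ , _} (a , a') → inj₂ (inj₂ (arcEdge arcs a , arcEdge arcs' a')) }
  ; arcAsym = λ { {_ , _} {_ , _} (a , _) (b , _) → arcAsym arcs a b }
  }
  where open IsArcSet

transClosure-map : ∀ {R : X → X → Set} {S : Y → Y → Set} (f : X → Y)
  → (∀ {x y} → R x y → S (f x) (f y))
  → ∀ {x y} → TransClosure R x y → TransClosure S (f x) (f y)
transClosure-map f R⇒S [ r ]    = [ R⇒S r ]
transClosure-map f R⇒S (r ∷ rs) = R⇒S r ∷ transClosure-map f R⇒S rs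

productArcs-isPathCollection : ∀ {A : X → X → Set} {A' : Y → Y → Set}
  → IsPathCollection A → IsPathCollection A' → IsPathCollection (ProductArcs A A')
productArcs-isPathCollection paths paths' = record
  { inDeg≤1  = λ { {_ , _} {_ , _} {_ , _} (a , a') (b , b') →
                 cong₂ _,_ (inDeg≤1 paths a b) (inDeg≤1 paths' a' b') }
  ; outDeg≤1 = λ { {_ , _} {_ , _} {_ , _} (a , a') (b , b') →
                 cong₂ _,_ (outDeg≤1 paths a b) (outDeg≤1 paths' a' b') }
  ; acyclic  = acyclic paths ∘ transClosure-map proj₁ proj₁
  }
  where open IsPathCollection

module ProductSources (A : X → X → Set) (A' : Y → Y → Set) where

  source-productˡ : ∀ {x x'} → Source A x → Source (ProductArcs A A') (x , x')
  source-productˡ src (w , _) (a , _) = src w a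

  source-productʳ : ∀ {x x'} → Source A' x' → Source (ProductArcs A A') (x , x')
  source-productʳ src (_ , w') (_ , a') = src w' a'

pairArc : X × X → Y × Y → (X × Y) × (X × Y)
pairArc (u , v) (u' , v') = (u , u') , (v , v')

∈-pairArcs⁻ : ∀ (L : List (X × X)) (L' : List (Y × Y)) {u u' v v'}
  → ((u , u') , (v , v')) ∈ cartesianProductWith pairArc L L' → (u , v) ∈ L × (u' , v') ∈ L'
∈-pairArcs⁻ L L' m with ∈-cartesianProductWith⁻ pairArc L L' m
... | (_ , _) , (_ , _) , m₁ , m₂ , refl = m₁ , m₂

Targets-pairArcs⁺ : ∀ {L : List (X × X)} {L' : List (Y × Y)} {y y'}
  → Targets L y → Targets L' y' → Targets (cartesianProductWith pairArc L L') (y , y')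
Targets-pairArcs⁺ (x , m) (x' , m') = (x , x') , ∈-cartesianProductWith⁺ pairArc m m'

Targets-pairArcs⁻ : ∀ (L : List (X × X)) (L' : List (Y × Y)) {y y'}
  → Targets (cartesianProductWith pairArc L L') (y , y') → Targets L y × Targets L' y'
Targets-pairArcs⁻ L L' ((x , x') , m) =
  let m₁ , m₂ = ∈-pairArcs⁻ L L' m in (x , m₁) , (x' , m₂)

Targets-row⁺ : ∀ {u v : X} {L' : List (Y × Y)} {y'}
  → Targets L' y' → Targets (map (pairArc (u , v)) L') (v , y')
Targets-row⁺ (x' , m) = (_ , x') , ∈-map⁺ (pairArc _) m

Targets-row⁻ : ∀ {a : X × X} {L' : List (Y × Y)} {y y'}
  → Targets (map (pairArc a) L') (y , y') → Targets L' y'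
Targets-row⁻ (_ , m) with ∈-map⁻ (pairArc _) m
... | (x' , _) , m′ , refl = x' , m′

module ProductForcing
  {V V' : Set} {Adj : V → V → Set} {Adj' : V' → V' → Set} (_≟_ : DecidableEquality V)
  {A : V → V → Set} {A' : V' → V' → Set}
  (forcingA : IsForcingArcSet Adj A) (forcingA' : IsForcingArcSet Adj' A')
  where

  module G  = IsForcingArcSet forcingA
  module G' = IsForcingArcSet forcingA'
  open StrongClosedNbhd Adj Adj'
  open ProductSources A A'

  Blue* : List ((V × V') × (V × V')) → Pred (V × V') 0ℓ
  Blue* pre = Source (ProductArcs A A') ∪ Targets pre

  productForces : List ((V × V') × (V × V'))
  productForces = cartesianProductWith pairArc G.forces G'.forces

  endsBlue' : ∀ x' → (Source A' ∪ Targets G'.forces) x'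
  endsBlue' x' = map₂ ∈-map-proj₂⇒Targets (G'.allBlue x')

  earlierRows-blue : ∀ {preF x x'} → (Source A ∪ Targets preF) x
    → Blue* (cartesianProductWith pairArc preF G'.forces) (x , x')
  earlierRows-blue (inj₁ src) = inj₁ (source-productˡ src)
  earlierRows-blue {x' = x'} (inj₂ t) with endsBlue' x'
  ... | inj₁ src' = inj₁ (source-productʳ src')
  ... | inj₂ t'   = inj₂ (Targets-pairArcs⁺ t t')

  currentRow-blue : ∀ {u v preF'} (prev : List _) {x'} → (Source A' ∪ Targets preF') x'
    → Blue* (prev ++ map (pairArc (u , v)) preF') (v , x')
  currentRow-blue prev (inj₁ src') = inj₁ (source-productʳ src')
  currentRow-blue prev (inj₂ t')   = inj₂ (Targets-++⁺ʳ prev (Targets-row⁺ t'))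

  productForce-valid : ∀ {pre f} → Split productForces pre f
    → Forces (StrongAdj Adj Adj') (Blue* pre) f
  productForce-valid s with split-cartesianProductWith pairArc G.forces G'.forces s
  ... | preF , (u , v) , sF , preF' , (u' , v') , sF' , refl , refl =
    forces blueU* whiteV* (closedNbhd-⊠⁺ F.adjacent F'.adjacent) othersBlue*
    where
    module F  = Forces (validForcing⁻ Adj  (Source A)  G.valid  sF)
    module F' = Forces (validForcing⁻ Adj' (Source A') G'.valid sF')
    open Equivalence

    prev = cartesianProductWith pairArc preF G'.forces

    blueU* : Blue* (prev ++ _) (u , u')
    blueU* = map₂ Targets-++⁺ˡ (earlierRows-blue F.forcerBlue)

    whiteV* : ¬ Blue* (prev ++ _) (v , v')
    whiteV* (inj₁ src) = src (u , u') ( from (G.arcs⇔forces u v) (Split⇒∈ sF)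
                                      , from (G'.arcs⇔forces u' v') (Split⇒∈ sF'))
    whiteV* (inj₂ t) with Targets-++⁻ prev t
    ... | inj₁ t′ = F.forcedWhite  (inj₂ (proj₁ (Targets-pairArcs⁻ preF G'.forces t′)))
    ... | inj₂ t′ = F'.forcedWhite (inj₂ (Targets-row⁻ t′))

    othersBlue* : ∀ w → InClosedNbhd (StrongAdj Adj Adj') (u , u') w → w ≢ (v , v')
      → Blue* (prev ++ _) w
    othersBlue* (x , x') uw w≢v with closedNbhd-⊠⁻ uw | x ≟ v
    ... | _ , ux' | yes refl =
      currentRow-blue prev (F'.othersBlue x' ux' (w≢v ∘ cong (v ,_)))
    ... | ux , _  | no x≢v   =
      map₂ Targets-++⁺ˡ (earlierRows-blue (F.othersBlue x ux x≢v))

  isForcingArcSet : IsForcingArcSet (StrongAdj Adj Adj') (ProductArcs A A')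
  isForcingArcSet = record
    { arcSet      = productArcs-isArcSet G.arcSet G'.arcSet
    ; paths       = productArcs-isPathCollection G.paths G'.paths
    ; forces      = productForces
    ; valid       = validForcing⁺ _ _ productForces productForce-valid
    ; forcedOnce  = λ { {_ , _} {_ , _} {_ , _} m n →
        let m₁ , m₂ = ∈-pairArcs⁻ G.forces G'.forces m
            n₁ , n₂ = ∈-pairArcs⁻ G.forces G'.forces n
        in  cong₂ _,_ (G.forcedOnce m₁ n₁) (G'.forcedOnce m₂ n₂) }
    ; allBlue     = λ (x , x') → map₂ Targets⇒∈-map-proj₂
        (earlierRows-blue (map₂ ∈-map-proj₂⇒Targets (G.allBlue x)))
    ; arcs⇔forces = λ (u , u') (v , v') → mk⇔
        (λ (a , a') → ∈-cartesianProductWith⁺ pairArc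
                        (to (G.arcs⇔forces u v) a) (to (G'.arcs⇔forces u' v') a'))
        (λ m → let m₁ , m₂ = ∈-pairArcs⁻ G.forces G'.forces m
               in  from (G.arcs⇔forces u v) m₁ , from (G'.arcs⇔forces u' v') m₂)
    }
    where open Equivalence

proposition5p5 : {V V' : Set} {Adj : V → V → Set} {Adj' : V' → V' → Set}
    → IsFiniteSimpleGraph V Adj → IsFiniteSimpleGraph V' Adj'
    → (A : V → V → Set) (A' : V' → V' → Set)
    → IsForcingArcSet Adj A → IsForcingArcSet Adj' A'
    → IsForcingArcSet (StrongAdj Adj Adj') (ProductArcs A A')
-- Finiteness is only used to decide equality of the vertices of G.
proposition5p5 G _ A A' forcingA forcingA' =
  ProductForcing.isForcingArcSet (inj⇒≟ (↔⇒↣ (IsFiniteSimpleGraph.finite G))) forcingA forcingA'
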